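{- Let $k_1,\dots,k_m$ and $r_1,\dots,r_n$ be positive integers. Then $L_{k_1}\times\cdots\times L_{k_m}\equiv L_{r_1}\times\cdots\times L_{r_n}$ if and only if the two products consist of exactly the same devices, i.e., $m=n$ and the multisets $\{k_1,\dots,k_m\}$ and $\{r_1,\dots,r_n\}$ coincide.
   Context: An ASD is a pair $D=(\mathcal{S}_D,\mathcal{P}_D)$ with $\mathcal{S}_D$ a finite set and $\mathcal{P}_D$ a finite family of set partitions of $\mathcal{S}_D$. For partitions, $\pi\preceq\pi'$ means every block of $\pi$ lies in a block of $\pi'$; for $\phi:\mathcal{S}\to\mathcal{S}'$ and a partition $\pi$ of $\mathcal{S}'$, $\pi\circ\phi$ is the partition of $\mathcal{S}$ where $x,y$ share a block iff $\phi(x),\phi(y)$ share a block of $\pi$. $D\le D'$ means there exist $\phi:\mathcal{S}_D\to\mathcal{S}_{D'}$, $\alpha:\mathcal{P}_D\to\mathcal{P}_{D'}$ with $\alpha(\pi)\circ\phi\preceq\pi$ for all $\pi$; $D\equiv D'$ means $D\le D'$ and $D'\le D$. The direct product $D\times D'$ has state space $\mathcal{S}_D\times\mathcal{S}_{D'}$ and partition set $\{\pi\times\pi'\}$ with $\pi\times\pi'=\{B\times B':B\in\pi,B'\in\pi'\}$. For a positive integer $n$, the (binary) linear device $L_n$ has state space $\{0,1\}^n$ and partition set consisting of the kernel partitions (partition into fibers) of all linear maps $\{0,1\}^n\to\{0,1\}$ over $\mathbb{F}_2$. -}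

module Defs where

open import Level using (Level; 0ℓ)
open import Data.Bool using (Bool; true; false; _∧_; _xor_)
open import Data.Nat using (ℕ; zero; suc)
open import Data.Vec using (Vec; []; _∷_)
open import Data.Product using (Σ; _×_; _,_; proj₁; proj₂)
open import Data.List.NonEmpty using (List⁺; _∷_)
open import Data.List using (List; []; _∷_)
open import Relation.Binary.PropositionalEquality using (_≡_)

-- A set partition of S, given by a block-labelling: x and y lie in the same
-- block iff they receive the same label (blocks = nonempty fibres).
record Partition (S : Set) : Set₁ where
  constructor mkPartition
  field
    Label : Set
    label : S → Label

open Partition public

SameBlock : {S : Set} → Partition S → S → S → Set
SameBlock π x y = label π x ≡ label π y

_⪯_ : {S : Set} → Partition S → Partition S → Set
π ⪯ π' = ∀ x y → SameBlock π x y → SameBlock π' x y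

_∘ₚ_ : {S S' : Set} → Partition S' → (S → S') → Partition S
π ∘ₚ φ = mkPartition (Label π) (λ x → label π (φ x))

record ASD : Set₁ where
  constructor mkASD
  field
    State : Set
    Idx   : Set
    part  : Idx → Partition State

open ASD public

_≤ᴰ_ : ASD → ASD → Set
D ≤ᴰ D' = Σ (State D → State D') λ φ → Σ (Idx D → Idx D') λ α →
            ∀ i → (part D' (α i) ∘ₚ φ) ⪯ part D i

_≡ᴰ_ : ASD → ASD → Set
D ≡ᴰ D' = (D ≤ᴰ D') × (D' ≤ᴰ D)

_×ₚ_ : {S S' : Set} → Partition S → Partition S' → Partition (S × S')
π ×ₚ π' = mkPartition (Label π × Label π') (λ p → label π (proj₁ p) , label π' (proj₂ p))

_×ᴰ_ : ASD → ASD → ASD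
D ×ᴰ D' = mkASD (State D × State D') (Idx D × Idx D')
                (λ ij → part D (proj₁ ij) ×ₚ part D' (proj₂ ij))

-- F₂-linear functional x ↦ Σ aᵢ xᵢ on {0,1}^n (every linear map {0,1}^n → {0,1}
-- is of this form for a unique a ∈ {0,1}^n)
dot : {n : ℕ} → Vec Bool n → Vec Bool n → Bool
dot [] [] = false
dot (a ∷ as) (x ∷ xs) = (a ∧ x) xor dot as xs

kernelPartition : {S : Set} → (S → Bool) → Partition S
kernelPartition f = mkPartition Bool f

L : ℕ → ASD
L n = mkASD (Vec Bool n) (Vec Bool n) (λ a → kernelPartition (dot a))

prodL′ : ℕ → List ℕ → ASD
prodL′ k [] = L k
prodL′ k (k' ∷ ks) = L k ×ᴰ prodL′ k' ks

prodL : List⁺ ℕ → ASD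
prodL (k ∷ ks) = prodL′ k ks

module Submission where

-- For every t we attach to a device D a number h_t(D): the largest H
-- such that some t partitions of D jointly separate an embedded H-cube
-- {0,1}^H, while every t partitions of D are jointly determined by H bits.
-- Both bounds are witnessed separately ('Separating' and 'Compressible'), and
-- a counting argument (no injection {0,1}^H → {0,1}^H' when H' < H) shows
-- that D ≤ D' forces h_t(D) ≤ h_t(D').  For L_k both bounds hold with
-- H = min(k,t), and both are additive over products, so for a product of
-- L_{k_i} the invariant is the "capacity" Σᵢ min(kᵢ,t).  Equivalent products
-- therefore have equal capacities for all t, and successive differences of
-- capacities recover how many kᵢ equal each value v ≥ 1; equal multiplicities
-- give a permutation.  Conversely, ×ᴰ is associative and commutative up to ≡ᴰ,
-- so permuted products are equivalent.

open import Defs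
open import Data.Bool using (Bool; true; false; T; if_then_else_; _xor_)
open import Data.Bool.Properties using (xor-comm)
open import Data.Fin using (Fin; zero; suc; funToFin; finToFun; combine)
open import Data.Fin.Properties using (funToFin-finToFin; finToFun-funToFin; injective⇒≤)
open import Data.List using (List; []; _∷_; _++_; map)
open import Data.List.Membership.Propositional using (_∈_)
open import Data.List.Membership.Propositional.Properties using (∈-∃++)
open import Data.List.NonEmpty using (List⁺; toList; _∷_)
open import Data.List.Relation.Unary.All using (All; []; _∷_)
open import Data.List.Relation.Unary.Any using (here; there)
open import Data.List.Relation.Binary.Permutation.Propositional
  using (_↭_; refl; prep; swap; trans; ↭-sym)
open import Data.List.Relation.Binary.Permutation.Propositional.Properties using (map⁺; shift)
open import Data.Nat using (ℕ; zero; suc; _+_; _^_; _⊓_; _≤_; _<_; z≤n; s≤s; _<ᵇ_; _≡ᵇ_)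
open import Data.Nat.ListAction using (sum)
open import Data.Nat.ListAction.Properties using (sum-↭)
open import Data.Nat.Properties
  using (≤-antisym; ≤-total; ≮⇒≥; <⇒≱; ^-monoʳ-<; +-cancelˡ-≡; +-cancelʳ-≡;
         m≤n⇒m⊓n≡m; m≥n⇒m⊓n≡n; ⊓-zeroʳ; ≡ᵇ⇒≡; ≡⇒≡ᵇ; +-commutativeSemigroup)
open import Algebra.Properties.CommutativeSemigroup +-commutativeSemigroup using (interchange)
open import Data.Product using (_×_; _,_; proj₁; proj₂)
open import Data.Sum using (inj₁; inj₂)
open import Data.Unit using (⊤; tt)
open import Data.Vec using (Vec; []; _∷_; replicate; take; drop; tabulate; lookup)
  renaming (_++_ to _++ᵛ_)
open import Data.Vec.Properties
  using (take++drop≡id; ++-injective; lookup∘tabulate; tabulate∘lookup; tabulate-cong)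
open import Function using (_∘_)
open import Function.Bundles using (_⇔_; mk⇔)
open import Relation.Binary.PropositionalEquality
  using (_≡_; _≗_; refl; sym; cong; cong₂; subst; module ≡-Reasoning)
  renaming (trans to ≡-trans)

-- 1. The preorder ≤ᴰ and products of lists of devices

≤ᴰ-refl : {D : ASD} → D ≤ᴰ D
≤ᴰ-refl = (λ x → x) , (λ i → i) , λ i x y same → same

-- (the devices are explicit: they cannot be inferred through the unfolding of ≤ᴰ)
≤ᴰ-trans : (D E F : ASD) → D ≤ᴰ E → E ≤ᴰ F → D ≤ᴰ F
≤ᴰ-trans _ _ _ (φ₁ , α₁ , refines₁) (φ₂ , α₂ , refines₂) =
  φ₂ ∘ φ₁ , α₂ ∘ α₁ ,
  λ i x y same → refines₁ i x y (refines₂ (α₁ i) (φ₁ x) (φ₁ y) same)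

×ᴰ-monoʳ : (A X Y : ASD) → X ≤ᴰ Y → (A ×ᴰ X) ≤ᴰ (A ×ᴰ Y)
×ᴰ-monoʳ A X Y (φ , α , refines) =
  (λ p → proj₁ p , φ (proj₂ p)) , (λ i → proj₁ i , α (proj₂ i)) ,
  λ i x y same → cong₂ _,_ (cong proj₁ same)
                           (refines (proj₂ i) (proj₂ x) (proj₂ y) (cong proj₂ same))

×ᴰ-exchange : (A B X : ASD) → (A ×ᴰ (B ×ᴰ X)) ≤ᴰ (B ×ᴰ (A ×ᴰ X))
×ᴰ-exchange A B X = exchange , exchange , λ i x y same → cong exchange same
  where
  exchange : {P Q R : Set} → P × (Q × R) → Q × (P × R)
  exchange (p , q , r) = q , p , r

𝟙ᴰ : ASD
𝟙ᴰ = mkASD ⊤ ⊤ (λ _ → mkPartition ⊤ (λ _ → tt))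

ΠL : List ℕ → ASD
ΠL []       = 𝟙ᴰ
ΠL (k ∷ ks) = L k ×ᴰ ΠL ks

ΠL-↭ : {ks rs : List ℕ} → ks ↭ rs → ΠL ks ≤ᴰ ΠL rs
ΠL-↭ refl                     = ≤ᴰ-refl
ΠL-↭ (prep {xs} {ys} k p)     = ×ᴰ-monoʳ (L k) (ΠL xs) (ΠL ys) (ΠL-↭ p)
ΠL-↭ (swap {xs} {ys} k r p)   =
  ≤ᴰ-trans (L k ×ᴰ (L r ×ᴰ ΠL xs)) (L r ×ᴰ (L k ×ᴰ ΠL xs)) (L r ×ᴰ (L k ×ᴰ ΠL ys))
    (×ᴰ-exchange (L k) (L r) (ΠL xs))
    (×ᴰ-monoʳ (L r) (L k ×ᴰ ΠL xs) (L k ×ᴰ ΠL ys) (×ᴰ-monoʳ (L k) (ΠL xs) (ΠL ys) (ΠL-↭ p)))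
ΠL-↭ (trans {xs} {ys} {zs} p q) = ≤ᴰ-trans (ΠL xs) (ΠL ys) (ΠL zs) (ΠL-↭ p) (ΠL-↭ q)

prodL′≤ΠL : (k : ℕ) (ks : List ℕ) → prodL′ k ks ≤ᴰ ΠL (k ∷ ks)
prodL′≤ΠL k []        = (λ x → x , tt) , (λ i → i , tt) , λ i x y same → cong proj₁ same
prodL′≤ΠL k (k′ ∷ ks) = ×ᴰ-monoʳ (L k) (prodL′ k′ ks) (ΠL (k′ ∷ ks)) (prodL′≤ΠL k′ ks)

ΠL≤prodL′ : (k : ℕ) (ks : List ℕ) → ΠL (k ∷ ks) ≤ᴰ prodL′ k ks
ΠL≤prodL′ k []        = proj₁ , proj₁ , λ i x y same → cong (_, tt) same
ΠL≤prodL′ k (k′ ∷ ks) = ×ᴰ-monoʳ (L k) (ΠL (k′ ∷ ks)) (prodL′ k′ ks) (ΠL≤prodL′ k′ ks)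

prodL′-≤⇒ΠL : (k r : ℕ) (ks rs : List ℕ) →
  prodL′ k ks ≤ᴰ prodL′ r rs → ΠL (k ∷ ks) ≤ᴰ ΠL (r ∷ rs)
prodL′-≤⇒ΠL k r ks rs le =
  ≤ᴰ-trans (ΠL (k ∷ ks)) (prodL′ k ks) (ΠL (r ∷ rs)) (ΠL≤prodL′ k ks)
    (≤ᴰ-trans (prodL′ k ks) (prodL′ r rs) (ΠL (r ∷ rs)) le (prodL′≤ΠL r rs))

ΠL-≤⇒prodL′ : (k r : ℕ) (ks rs : List ℕ) →
  ΠL (k ∷ ks) ≤ᴰ ΠL (r ∷ rs) → prodL′ k ks ≤ᴰ prodL′ r rs
ΠL-≤⇒prodL′ k r ks rs le =
  ≤ᴰ-trans (prodL′ k ks) (ΠL (k ∷ ks)) (prodL′ r rs) (prodL′≤ΠL k ks)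
    (≤ᴰ-trans (ΠL (k ∷ ks)) (ΠL (r ∷ rs)) (prodL′ r rs) le (ΠL≤prodL′ r rs))

-- 2. Counting: no injection from a larger Boolean cube into a smaller one

-- {0,1}^n is in bijection with Fin (2 ^ n), via functions Fin n → Fin 2.
module CubeEncoding where

  bit : Bool → Fin 2
  bit false = zero
  bit true  = suc zero

  unbit : Fin 2 → Bool
  unbit zero       = false
  unbit (suc zero) = true

  unbit-bit : (b : Bool) → unbit (bit b) ≡ b
  unbit-bit false = refl
  unbit-bit true  = refl

  bit-unbit : (i : Fin 2) → bit (unbit i) ≡ i
  bit-unbit zero       = refl
  bit-unbit (suc zero) = refl

  funToFin-cong : {m n : ℕ} {f g : Fin m → Fin n} → f ≗ g → funToFin f ≡ funToFin g
  funToFin-cong {zero}  f≗g = refl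
  funToFin-cong {suc m} f≗g = cong₂ combine (f≗g zero) (funToFin-cong (f≗g ∘ suc))

  encode : {n : ℕ} → Vec Bool n → Fin (2 ^ n)
  encode v = funToFin (bit ∘ lookup v)

  -- (n is explicit: it cannot be recovered from the type Fin (2 ^ n))
  decode : (n : ℕ) → Fin (2 ^ n) → Vec Bool n
  decode n k = tabulate (unbit ∘ finToFun {2} {n} k)

  decode-encode : {n : ℕ} (v : Vec Bool n) → decode n (encode v) ≡ v
  decode-encode v = begin
    tabulate (unbit ∘ finToFun (funToFin (bit ∘ lookup v)))
      ≡⟨ tabulate-cong (λ i → ≡-trans (cong unbit (finToFun-funToFin (bit ∘ lookup v) i))
                                      (unbit-bit (lookup v i))) ⟩
    tabulate (lookup v)
      ≡⟨ tabulate∘lookup v ⟩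
    v ∎
    where open ≡-Reasoning

  encode-decode : (n : ℕ) (k : Fin (2 ^ n)) → encode (decode n k) ≡ k
  encode-decode n k = begin
    funToFin (bit ∘ lookup (tabulate (unbit ∘ finToFun {2} {n} k)))
      ≡⟨ funToFin-cong (λ i → ≡-trans (cong bit (lookup∘tabulate (unbit ∘ finToFun {2} {n} k) i))
                                      (bit-unbit (finToFun {2} {n} k i))) ⟩
    funToFin (finToFun {2} {n} k)
      ≡⟨ funToFin-finToFin {n} {2} k ⟩
    k ∎
    where open ≡-Reasoning

cube-injection⇒≤ : {m n : ℕ} (f : Vec Bool m → Vec Bool n) →
                   (∀ u v → f u ≡ f v → u ≡ v) → m ≤ n
cube-injection⇒≤ {m} {n} f f-injective =
  ≮⇒≥ λ n<m → <⇒≱ (^-monoʳ-< 2 (s≤s (s≤s z≤n)) n<m) (injective⇒≤ g-injective)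
  where
  open CubeEncoding
  g : Fin (2 ^ m) → Fin (2 ^ n)
  g = encode ∘ f ∘ decode m

  g-injective : {i j : Fin (2 ^ m)} → g i ≡ g j → i ≡ j
  g-injective {i} {j} gi≡gj = begin
    i                    ≡⟨ sym (encode-decode m i) ⟩
    encode (decode m i)  ≡⟨ cong encode (f-injective (decode m i) (decode m j) f-agrees) ⟩
    encode (decode m j)  ≡⟨ encode-decode m j ⟩
    j ∎
    where
    open ≡-Reasoning
    f-agrees : f (decode m i) ≡ f (decode m j)
    f-agrees = ≡-trans (sym (decode-encode _))
                       (≡-trans (cong (decode n) gi≡gj) (decode-encode _))

-- 3. Lower and upper witnesses for the invariant h_t

-- t partitions of D jointly separating an embedded H-cube: h_t(D) ≥ H.
record Separating (D : ASD) (H t : ℕ) : Set where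
  field
    embed     : Vec Bool H → State D
    tests     : Fin t → Idx D
    separates : ∀ u v → (∀ s → SameBlock (part D (tests s)) (embed u) (embed v)) → u ≡ v

-- Every t partitions of D are jointly determined by an H-bit code: h_t(D) ≤ H.
record Compressible (D : ASD) (H t : ℕ) : Set where
  field
    code       : (Fin t → Idx D) → State D → Vec Bool H
    determines : ∀ tests x y → code tests x ≡ code tests y →
                 ∀ s → SameBlock (part D (tests s)) x y

-- The key monotonicity: a separated H-cube of D is carried by D ≤ᴰ D' into
-- D', where it must fit into H' code bits.
separating≤compressible : {D D' : ASD} {H H' t : ℕ} →
  D ≤ᴰ D' → Separating D H t → Compressible D' H' t → H ≤ H'
separating≤compressible (φ , α , refines) sep comp =
  cube-injection⇒≤ (code (α ∘ tests) ∘ φ ∘ embed)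
    λ u v same-code → separates u v λ s →
      refines (tests s) (embed u) (embed v) (determines (α ∘ tests) _ _ same-code s)
  where
  open Separating sep
  open Compressible comp

-- Both witnesses are additive over products (cubes are concatenated).
separating-× : {D D' : ASD} {H₁ H₂ t : ℕ} →
  Separating D H₁ t → Separating D' H₂ t → Separating (D ×ᴰ D') (H₁ + H₂) t
separating-× {H₁ = H₁} sep₁ sep₂ = record
  { embed     = λ u → S₁.embed (take H₁ u) , S₂.embed (drop H₁ u)
  ; tests     = λ s → S₁.tests s , S₂.tests s
  ; separates = λ u v same → begin
      u                          ≡⟨ sym (take++drop≡id H₁ u) ⟩
      take H₁ u ++ᵛ drop H₁ u    ≡⟨ cong₂ _++ᵛ_ (S₁.separates _ _ (cong proj₁ ∘ same))
                                                (S₂.separates _ _ (cong proj₂ ∘ same)) ⟩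
      take H₁ v ++ᵛ drop H₁ v    ≡⟨ take++drop≡id H₁ v ⟩
      v ∎
  }
  where
  open ≡-Reasoning
  module S₁ = Separating sep₁
  module S₂ = Separating sep₂

compressible-× : {D D' : ASD} {H₁ H₂ t : ℕ} →
  Compressible D H₁ t → Compressible D' H₂ t → Compressible (D ×ᴰ D') (H₁ + H₂) t
compressible-× comp₁ comp₂ = record
  { code       = λ tests x → C₁.code (proj₁ ∘ tests) (proj₁ x) ++ᵛ C₂.code (proj₂ ∘ tests) (proj₂ x)
  ; determines = λ tests x y same s →
      let halves = ++-injective (C₁.code (proj₁ ∘ tests) (proj₁ x))
                                (C₁.code (proj₁ ∘ tests) (proj₁ y)) same
      in cong₂ _,_ (C₁.determines (proj₁ ∘ tests) _ _ (proj₁ halves) s)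
                   (C₂.determines (proj₂ ∘ tests) _ _ (proj₂ halves) s)
  }
  where
  module C₁ = Compressible comp₁
  module C₂ = Compressible comp₂

separating-𝟙 : (t : ℕ) → Separating 𝟙ᴰ 0 t
separating-𝟙 t = record
  { embed = λ _ → tt ; tests = λ _ → tt ; separates = λ { [] [] _ → refl } }

compressible-𝟙 : (t : ℕ) → Compressible 𝟙ᴰ 0 t
compressible-𝟙 t = record { code = λ _ _ → [] ; determines = λ _ _ _ _ _ → refl }

-- For L_k: the first min(k,t) coordinate functionals separate the
-- coordinate subcube of dimension min(k,t).
module LinearSeparating where

  dot-zeros : {n : ℕ} (x : Vec Bool n) → dot (replicate n false) x ≡ false
  dot-zeros []       = refl
  dot-zeros (x ∷ xs) = dot-zeros xs

  dot-first : {n : ℕ} (b : Bool) (x : Vec Bool n) → dot (true ∷ replicate n false) (b ∷ x) ≡ b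
  dot-first b x = ≡-trans (cong (b xor_) (dot-zeros x)) (xor-comm b false)

  pad : (k t : ℕ) → Vec Bool (k ⊓ t) → Vec Bool k
  pad zero    t       u       = []
  pad (suc k) zero    u       = replicate (suc k) false
  pad (suc k) (suc t) (b ∷ u) = b ∷ pad k t u

  -- coordinate k t s: the s-th coordinate functional on {0,1}^k (zero if s ≥ k)
  coordinate : (k t : ℕ) → Fin t → Vec Bool k
  coordinate zero    t       s       = []
  coordinate (suc k) (suc t) zero    = true ∷ replicate k false
  coordinate (suc k) (suc t) (suc s) = false ∷ coordinate k t s

  pad-separated : (k t : ℕ) (u v : Vec Bool (k ⊓ t)) →
    (∀ s → dot (coordinate k t s) (pad k t u) ≡ dot (coordinate k t s) (pad k t v)) → u ≡ v
  pad-separated zero    t       []      []       _    = refl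
  pad-separated (suc k) zero    []      []       _    = refl
  pad-separated (suc k) (suc t) (b ∷ u) (b′ ∷ v) same =
    cong₂ _∷_ first-agrees (pad-separated k t u v (same ∘ suc))
    where
    first-agrees : b ≡ b′
    first-agrees = ≡-trans (sym (dot-first b (pad k t u)))
                           (≡-trans (same zero) (dot-first b′ (pad k t v)))

separating-L : (k t : ℕ) → Separating (L k) (k ⊓ t) t
separating-L k t = record
  { embed = pad k t ; tests = coordinate k t ; separates = pad-separated k t }
  where open LinearSeparating

-- For L_r: t functionals are determined both by the point itself (r bits)
-- and by their own t values.
compressible-L-states : (r t : ℕ) → Compressible (L r) r t
compressible-L-states r t = record
  { code = λ _ x → x ; determines = λ tests x y same s → cong (dot (tests s)) same }

compressible-L-values : (r t : ℕ) → Compressible (L r) t t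
compressible-L-values r t = record { code = values ; determines = determined }
  where
  open ≡-Reasoning
  values : (Fin t → Vec Bool r) → Vec Bool r → Vec Bool t
  values tests x = tabulate (λ s → dot (tests s) x)

  determined : ∀ tests x y → values tests x ≡ values tests y → ∀ s → dot (tests s) x ≡ dot (tests s) y
  determined tests x y same s = begin
    dot (tests s) x            ≡⟨ sym (lookup∘tabulate (λ s′ → dot (tests s′) x) s) ⟩
    lookup (values tests x) s  ≡⟨ cong (λ w → lookup w s) same ⟩
    lookup (values tests y) s  ≡⟨ lookup∘tabulate (λ s′ → dot (tests s′) y) s ⟩
    dot (tests s) y ∎

compressible-L : (r t : ℕ) → Compressible (L r) (r ⊓ t) t
compressible-L r t with ≤-total r t
... | inj₁ r≤t = subst (λ H → Compressible (L r) H t) (sym (m≤n⇒m⊓n≡m r≤t)) (compressible-L-states r t)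
... | inj₂ t≤r = subst (λ H → Compressible (L r) H t) (sym (m≥n⇒m⊓n≡n t≤r)) (compressible-L-values r t)

-- Hence h_t(ΠL ks) is the capacity Σ_{k ∈ ks} min(k,t), and it is monotone.
-- Σ_{k ∈ ks} f k; sums of this form are invariant under permutation
sumOf : (ℕ → ℕ) → List ℕ → ℕ
sumOf f ks = sum (map f ks)

capacity : ℕ → List ℕ → ℕ
capacity t = sumOf (_⊓ t)

separating-ΠL : (t : ℕ) (ks : List ℕ) → Separating (ΠL ks) (capacity t ks) t
separating-ΠL t []       = separating-𝟙 t
separating-ΠL t (k ∷ ks) = separating-× (separating-L k t) (separating-ΠL t ks)

compressible-ΠL : (t : ℕ) (ks : List ℕ) → Compressible (ΠL ks) (capacity t ks) t
compressible-ΠL t []       = compressible-𝟙 t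
compressible-ΠL t (k ∷ ks) = compressible-× (compressible-L k t) (compressible-ΠL t ks)

capacity-mono : (t : ℕ) (ks rs : List ℕ) → ΠL ks ≤ᴰ ΠL rs → capacity t ks ≤ capacity t rs
capacity-mono t ks rs le =
  separating≤compressible {ΠL ks} {ΠL rs} le (separating-ΠL t ks) (compressible-ΠL t rs)

-- 4. Capacities determine a multiset of positive numbers

indicator : Bool → ℕ
indicator b = if b then 1 else 0

above : ℕ → List ℕ → ℕ
above t = sumOf (λ k → indicator (t <ᵇ k))

multiplicity : ℕ → List ℕ → ℕ
multiplicity v = sumOf (λ k → indicator (k ≡ᵇ v))

sumOf-+ : {f g h : ℕ → ℕ} → (∀ k → f k ≡ g k + h k) →
          (ks : List ℕ) → sumOf f ks ≡ sumOf g ks + sumOf h ks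
sumOf-+ split []       = refl
sumOf-+ {f} {g} {h} split (k ∷ ks) = begin
  f k + sumOf f ks                        ≡⟨ cong₂ _+_ (split k) (sumOf-+ split ks) ⟩
  (g k + h k) + (sumOf g ks + sumOf h ks) ≡⟨ interchange (g k) (h k) _ _ ⟩
  (g k + sumOf g ks) + (h k + sumOf h ks) ∎
  where open ≡-Reasoning

sumOf-↭ : (f : ℕ → ℕ) {ks rs : List ℕ} → ks ↭ rs → sumOf f ks ≡ sumOf f rs
sumOf-↭ f p = sum-↭ (map⁺ f p)

⊓-suc : (k t : ℕ) → k ⊓ suc t ≡ k ⊓ t + indicator (t <ᵇ k)
⊓-suc zero    t       = refl
⊓-suc (suc k) zero    = cong suc (⊓-zeroʳ k)
⊓-suc (suc k) (suc t) = cong suc (⊓-suc k t)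

above-split : (p k : ℕ) → indicator (p <ᵇ k) ≡ indicator (k ≡ᵇ suc p) + indicator (suc p <ᵇ k)
above-split p       zero          = refl
above-split zero    (suc zero)    = refl
above-split zero    (suc (suc k)) = refl
above-split (suc p) (suc k)       = above-split p k

capacities⇒above : {xs ys : List ℕ} → (∀ t → capacity t xs ≡ capacity t ys) →
                   ∀ t → above t xs ≡ above t ys
capacities⇒above {xs} {ys} same t = +-cancelˡ-≡ (capacity t xs) _ _ (begin
  capacity t xs + above t xs  ≡⟨ sym (sumOf-+ (λ k → ⊓-suc k t) xs) ⟩
  capacity (suc t) xs         ≡⟨ same (suc t) ⟩
  capacity (suc t) ys         ≡⟨ sumOf-+ (λ k → ⊓-suc k t) ys ⟩
  capacity t ys + above t ys  ≡⟨ cong (_+ above t ys) (sym (same t)) ⟩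
  capacity t xs + above t ys  ∎)
  where open ≡-Reasoning

above⇒multiplicities : {xs ys : List ℕ} → (∀ t → above t xs ≡ above t ys) →
                       ∀ p → multiplicity (suc p) xs ≡ multiplicity (suc p) ys
above⇒multiplicities {xs} {ys} same p = +-cancelʳ-≡ (above (suc p) xs) _ _ (begin
  multiplicity (suc p) xs + above (suc p) xs  ≡⟨ sym (sumOf-+ (above-split p) xs) ⟩
  above p xs                                  ≡⟨ same p ⟩
  above p ys                                  ≡⟨ sumOf-+ (above-split p) ys ⟩
  multiplicity (suc p) ys + above (suc p) ys  ≡⟨ cong (multiplicity (suc p) ys +_) (sym (same (suc p))) ⟩
  multiplicity (suc p) ys + above (suc p) xs  ∎)
  where open ≡-Reasoning

-- positivity is exactly what makes the multiplicity of 0 recoverable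
multiplicity-zero : {xs : List ℕ} → All (0 <_) xs → multiplicity 0 xs ≡ 0
multiplicity-zero []             = refl
multiplicity-zero (s≤s _ ∷ pos) = multiplicity-zero pos

-- (the false branch is absurd, since T (v ≡ᵇ v) holds)
multiplicity-self : (v : ℕ) (xs : List ℕ) → 0 < multiplicity v (v ∷ xs)
multiplicity-self v xs with v ≡ᵇ v | ≡⇒≡ᵇ v v refl
... | true | _ = s≤s z≤n

multiplicity⇒∈ : (v : ℕ) (ys : List ℕ) → 0 < multiplicity v ys → v ∈ ys
multiplicity⇒∈ v (y ∷ ys) positive with y ≡ᵇ v in eq
... | true  = here (sym (≡ᵇ⇒≡ y v (subst T (sym eq) tt)))
... | false = there (multiplicity⇒∈ v ys positive)

multiplicities⇒↭ : (xs ys : List ℕ) → (∀ v → multiplicity v xs ≡ multiplicity v ys) → xs ↭ ys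
multiplicities⇒↭ [] []       _    = refl
multiplicities⇒↭ [] (y ∷ ys) same with subst (0 <_) (sym (same y)) (multiplicity-self y ys)
... | ()
multiplicities⇒↭ (x ∷ xs) ys same
  with as , bs , refl ← ∈-∃++ (multiplicity⇒∈ x ys (subst (0 <_) (same x) (multiplicity-self x xs)))
  = trans (prep x (multiplicities⇒↭ xs (as ++ bs) same-rest)) (↭-sym (shift x as bs))
  where
  same-rest : ∀ v → multiplicity v xs ≡ multiplicity v (as ++ bs)
  same-rest v = +-cancelˡ-≡ (indicator (x ≡ᵇ v)) _ _
    (≡-trans (same v) (sumOf-↭ (λ k → indicator (k ≡ᵇ v)) (shift x as bs)))

capacities⇒↭ : {xs ys : List ℕ} → All (0 <_) xs → All (0 <_) ys →
               (∀ t → capacity t xs ≡ capacity t ys) → xs ↭ ys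
capacities⇒↭ {xs} {ys} pos-xs pos-ys same = multiplicities⇒↭ xs ys same-multiplicity
  where
  same-multiplicity : ∀ v → multiplicity v xs ≡ multiplicity v ys
  same-multiplicity zero    = ≡-trans (multiplicity-zero pos-xs) (sym (multiplicity-zero pos-ys))
  same-multiplicity (suc p) = above⇒multiplicities {xs} {ys} (capacities⇒above {xs} {ys} same) p

corollary1 : (ks rs : List⁺ ℕ) →
    All (λ k → 0 < k) (toList ks) → All (λ r → 0 < r) (toList rs) →
    (prodL ks ≡ᴰ prodL rs) ⇔ (toList ks ↭ toList rs)
corollary1 (k ∷ ks) (r ∷ rs) pos-ks pos-rs = mk⇔ equivalent⇒permutation permutation⇒equivalent
  where
  equivalent⇒permutation : prodL′ k ks ≡ᴰ prodL′ r rs → (k ∷ ks) ↭ (r ∷ rs)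
  equivalent⇒permutation (le , ge) = capacities⇒↭ pos-ks pos-rs λ t →
    ≤-antisym (capacity-mono t (k ∷ ks) (r ∷ rs) (prodL′-≤⇒ΠL k r ks rs le))
              (capacity-mono t (r ∷ rs) (k ∷ ks) (prodL′-≤⇒ΠL r k rs ks ge))

  permutation⇒equivalent : (k ∷ ks) ↭ (r ∷ rs) → prodL′ k ks ≡ᴰ prodL′ r rs
  permutation⇒equivalent p = ΠL-≤⇒prodL′ k r ks rs (ΠL-↭ p) , ΠL-≤⇒prodL′ r k rs ks (ΠL-↭ (↭-sym p))
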